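{- Let $u = \diamond u'$ where $u'$ is a full word, let $v$ be any full word compatible with $u$, and set $w = uv$. If $w[1..2k]$ is a square and $|u| < 2k < |w|$, then there exists a position $i$ with $1 < i < |w|$ which starts a square in $w$ (i.e. some factor $w[i..j]$ is a square).
   Context: Let $\Sigma$ be a finite alphabet and $\diamond \notin \Sigma$ a hole symbol. A partial word is a finite sequence over $\Sigma \cup \{\diamond\}$; a full word is a partial word with no holes. Positions are indexed from $1$; $w[i]$ is the symbol at position $i$, $w[i..j]$ is the factor occupying positions $i$ to $j$ (said to start at position $i$), and $uv$ denotes concatenation. For partial words $u, v$ of equal length, $u \subset v$ means that every non-hole position of $u$ is a non-hole position of $v$ carrying the same letter; $u$ and $v$ are compatible if there is a partial word $z$ with $u \subset z$ and $v \subset z$ (in particular $|u| = |v|$). A partial word $u$ is a square if $u \subset x^2 = xx$ for some nonempty full word $x$. -}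

module Defs where

open import Data.Nat using (ℕ; suc; _∸_)
open import Data.List using (List; []; _∷_; map; take; drop; _++_)
open import Data.Maybe using (Maybe; just; nothing)
open import Data.Product using (Σ; _×_; ∃)
open import Relation.Binary.PropositionalEquality using (_≡_; _≢_)
open import Data.List.Relation.Binary.Pointwise using (Pointwise)

-- A partial word over alphabet A: `nothing` is the hole symbol ◇.
PWord : Set → Set
PWord A = List (Maybe A)

full : {A : Set} → List A → PWord A
full = map just

data _⊑_ {A : Set} : Maybe A → Maybe A → Set where
  hole⊑ : ∀ {b} → nothing ⊑ b
  sym⊑  : ∀ {a} → just a ⊑ just a

_⊂_ : {A : Set} → PWord A → PWord A → Set
u ⊂ v = Pointwise _⊑_ u v

Compatible : {A : Set} → PWord A → PWord A → Set
Compatible {A} u v = Σ (PWord A) λ z → (u ⊂ z) × (v ⊂ z)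

IsSquare : {A : Set} → PWord A → Set
IsSquare {A} u = Σ (List A) λ x → (x ≢ []) × (u ⊂ full (x ++ x))

-- The factor w[i..j] (1-indexed, inclusive), meaningful when 1 ≤ i ≤ j ≤ |w|.
factor : {A : Set} → ℕ → ℕ → PWord A → PWord A
factor i j w = take (suc j ∸ i) (drop (i ∸ 1) w)

module Submission where

open import Defs
open import Data.Nat using (ℕ; _<_; _≤_; _*_; _+_; _∸_; _⊓_; suc; zero; z≤n; s≤s)
open import Data.Nat.Properties
  using (≤-trans; <⇒≤; _<?_; +-comm; ≤-pred; m≤m+n; +-suc; +-mono-≤; +-monoʳ-≤; +-cancelˡ-≤;
         ≮⇒≥; <⇒≱; m≤n⇒m⊓n≡m; m+n∸m≡n)
open import Data.Fin using (Fin)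
open import Data.List using (List; []; _∷_; [_]; _++_; length; take; drop)
open import Data.List.Properties
  using (∷-injective; ++-assoc; ++-monoid; length-++; length-map; length-take;
         take-map; take++drop≡id; map-++)
open import Data.List.Relation.Binary.Pointwise using ([]; _∷_; tail)
import Data.List.Relation.Binary.Pointwise.Properties as Pointwise
open import Data.Maybe using (Maybe; nothing; just)
open import Data.Product using (Σ; _×_; _,_)
open import Data.Empty using (⊥-elim)
open import Function using (_∘_)
open import Relation.Nullary using (yes; no)
open import Relation.Binary.PropositionalEquality
  using (_≡_; _≢_; refl; sym; trans; cong; subst; subst₂; module ≡-Reasoning)

-- Write y = u' and w = ◇ y v.  Compatibility forces v = a y for a letter a, so
-- w = ◇ y a y.  If w[1..2k] ⊂ (c x)(c x), then y a y has the full prefix x c x,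
-- and the length bounds |u| < 2k < |w| become |x| < |y| ≤ 2|x|.  The two
-- occurrences of x (at 0 and |x|+1) therefore overlap the two copies of y in
-- a way that pins down the shape of the word: y = t a n c t with x = t a n,
-- so y a y = (t a n c) (t a)(t a) (n c t) contains the square (t a)(t a).
-- Since it lies after the hole of w, it starts at a position i with 1 < i < |w|.

module _ {A : Set} where

  InnerSquareStart : PWord A → Set
  InnerSquareStart w = Σ ℕ λ i → Σ ℕ λ j →
    (1 < i) × (i < length w) ×
    (i ≤ j) × (j ≤ length w) ×
    IsSquare (factor i j w)

  ⊂-refl : {w : PWord A} → w ⊂ w
  ⊂-refl = Pointwise.refl ⊑-refl
    where
      ⊑-refl : {m : Maybe A} → m ⊑ m
      ⊑-refl {nothing} = hole⊑
      ⊑-refl {just _}  = sym⊑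

  full-⊂-unique : (p q : List A) {z : PWord A} → full p ⊂ z → full q ⊂ z → p ≡ q
  full-⊂-unique []      []      []             []             = refl
  full-⊂-unique (x ∷ p) (y ∷ q) (sym⊑ ∷ p⊂z) (sym⊑ ∷ q⊂z) = cong (x ∷_) (full-⊂-unique p q p⊂z q⊂z)

  full-⊂-full : {p q : List A} → full p ⊂ full q → p ≡ q
  full-⊂-full {p} {q} p⊂q = full-⊂-unique p q p⊂q ⊂-refl

  compatible-hole-head : (u' v : List A) → Compatible (nothing ∷ full u') (full v) →
                         Σ A λ a → v ≡ a ∷ u'
  compatible-hole-head u' (a ∷ v') (_ ∷ z , _ ∷ u'⊂z , _ ∷ v'⊂z) =
    a , cong (a ∷_) (sym (full-⊂-unique u' v' u'⊂z v'⊂z))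

  factor-occurrence : (P S Q : PWord A) →
                      factor (suc (length P)) (length P + length S) (P ++ S ++ Q) ≡ S
  factor-occurrence P S Q = begin
    take (suc (length P + length S) ∸ suc (length P)) (drop (length P) (P ++ S ++ Q))
      ≡⟨ cong (λ n → take n (drop (length P) (P ++ S ++ Q))) (m+n∸m≡n (length P) (length S)) ⟩
    take (length S) (drop (length P) (P ++ S ++ Q))
      ≡⟨ cong (take (length S)) (drop-prefix P) ⟩
    take (length S) (S ++ Q)
      ≡⟨ take-prefix S ⟩
    S ∎
    where
      open ≡-Reasoning
      drop-prefix : (P : PWord A) {R : PWord A} → drop (length P) (P ++ R) ≡ R
      drop-prefix []      = refl
      drop-prefix (_ ∷ P) = drop-prefix P
      take-prefix : (S : PWord A) {R : PWord A} → take (length S) (S ++ R) ≡ S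
      take-prefix []      = refl
      take-prefix (x ∷ S) = cong (x ∷_) (take-prefix S)

  square-length : (s : List A) → s ≢ [] → 2 ≤ length (full (s ++ s))
  square-length []          s≢[] = ⊥-elim (s≢[] refl)
  square-length (_ ∷ [])    _    = s≤s (s≤s z≤n)
  square-length (_ ∷ _ ∷ _) _    = s≤s (s≤s z≤n)

  square-after-prefix : (P : PWord A) (s : List A) (Q : PWord A) → s ≢ [] → 1 ≤ length P →
                        InnerSquareStart (P ++ full (s ++ s) ++ Q)
  square-after-prefix P s Q s≢[] 1≤|P| =
    i , j , s≤s 1≤|P| , i<|w| , <⇒≤ i<j , j≤|w| , square
    where
      S = full (s ++ s)
      i = suc (length P)
      j = length P + length S
      |w|≡ : length (P ++ S ++ Q) ≡ length P + (length S + length Q)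
      |w|≡ = trans (length-++ P) (cong (length P +_) (length-++ S))
      j≤|w| : j ≤ length (P ++ S ++ Q)
      j≤|w| = subst (j ≤_) (sym |w|≡) (+-monoʳ-≤ (length P) (m≤m+n (length S) (length Q)))
      i<j : i < j
      i<j = subst (_≤ j) (+-comm (length P) 2) (+-monoʳ-≤ (length P) (square-length s s≢[]))
      i<|w| : i < length (P ++ S ++ Q)
      i<|w| = ≤-trans i<j j≤|w|
      square : IsSquare (factor i j (P ++ S ++ Q))
      square = subst IsSquare (sym (factor-occurrence P S Q)) (s , s≢[] , ⊂-refl)

  split-strict : (p q r s : List A) → p ++ q ≡ r ++ s → length p < length r →
                 Σ A λ b → Σ (List A) λ t → (r ≡ p ++ b ∷ t) × (q ≡ b ∷ t ++ s)
  split-strict []      q (b ∷ t) s eq _ = b , t , refl , eq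
  split-strict (x ∷ p) q (y ∷ r) s eq (s≤s p<r) with ∷-injective eq
  ... | refl , eq′ with split-strict p q r s eq′ p<r
  ... | b , t , refl , q≡ = b , t , refl , q≡

  shorter-remainder : (x t : List A) (c : A) → length (x ++ c ∷ t) ≤ length x + length x →
                      length t < length x
  shorter-remainder x t c bound =
    +-cancelˡ-≤ (length x) (suc (length t)) (length x) (subst (_≤ length x + length x) (length-++ x) bound)

  -- The word t a n c t a t a n c t, written so that the square (t a)(t a) is visible.
  unfold-overlap : (t n : List A) (a c : A) →
    ((t ++ a ∷ n) ++ c ∷ t) ++ a ∷ ((t ++ a ∷ n) ++ c ∷ t)
      ≡ (t ++ a ∷ n ++ [ c ]) ++ ((t ++ [ a ]) ++ (t ++ [ a ])) ++ (n ++ c ∷ t)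
  unfold-overlap t n a c = solve 4 (λ t n a c →
      ((t ⊕ a ⊕ n) ⊕ c ⊕ t) ⊕ a ⊕ ((t ⊕ a ⊕ n) ⊕ c ⊕ t)
    ⊜ (t ⊕ a ⊕ n ⊕ c) ⊕ ((t ⊕ a) ⊕ (t ⊕ a)) ⊕ (n ⊕ c ⊕ t)) refl t n [ a ] [ c ]
    where open import Algebra.Solver.Monoid (++-monoid A) using (solve; _⊜_; _⊕_)

  -- Word equation: if y a y has prefix x c x with |x| < |y| ≤ 2|x|, then
  -- y = t a n c t with x = t a n, hence y a y contains the square (t a)(t a).
  overlap-square : (y x e : List A) (a c : A) → y ++ a ∷ y ≡ (x ++ c ∷ x) ++ e →
                   length x < length y → length y ≤ length x + length x →
                   Σ (List A) λ p → Σ (List A) λ s → Σ (List A) λ r →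
                     (s ≢ []) × (y ++ a ∷ y ≡ p ++ (s ++ s) ++ r)
  overlap-square y x e a c eq x<y y≤2x
    with split-strict x (c ∷ x ++ e) y (a ∷ y) (trans (sym (++-assoc x (c ∷ x) e)) (sym eq)) x<y
  ... | b , t , refl , c∷x++e≡b∷t++a∷y with ∷-injective c∷x++e≡b∷t++a∷y
  ... | refl , x++e≡t++a∷y
    with split-strict t (a ∷ x ++ c ∷ t) x e (sym x++e≡t++a∷y) (shorter-remainder x t c y≤2x)
  ... | b′ , n , refl , a∷y≡b′∷n++e with ∷-injective a∷y≡b′∷n++e
  ... | refl , _ = t ++ a ∷ n ++ [ c ] , t ++ [ a ] , n ++ c ∷ t , ta≢[] t , unfold-overlap t n a c
    where
      ta≢[] : (t : List A) → t ++ [ a ] ≢ []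
      ta≢[] []      ()
      ta≢[] (_ ∷ _) ()

  full-++₃ : (p q r : List A) → full (p ++ q ++ r) ≡ full p ++ full q ++ full r
  full-++₃ p q r = trans (map-++ just p (q ++ r)) (cong (full p ++_) (map-++ just q r))

  half-< : (m n : ℕ) → m + suc m < n + suc n → m < n
  half-< m n lt with m <? n
  ... | yes m<n = m<n
  ... | no  m≮n = ⊥-elim (<⇒≱ lt (+-mono-≤ n≤m (s≤s n≤m)))
    where n≤m = ≮⇒≥ m≮n

  square-prefix : (y : List A) (a : A) (N : ℕ) → IsSquare (take N (nothing ∷ full (y ++ a ∷ y))) →
                  length (nothing ∷ full y) < N → N < length (nothing ∷ full (y ++ a ∷ y)) →
                  InnerSquareStart (nothing ∷ full (y ++ a ∷ y))
  square-prefix y a zero    _                    ()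
  square-prefix y a (suc m) ([] , x≢[] , _)     _  _  = ⊥-elim (x≢[] refl)
  square-prefix y a (suc m) (c ∷ x , _ , sq) lo hi =
    square-after-hole (overlap-square y x (drop m z) a c z≡ |x|<|y| |y|≤2|x|)
    where
      z = y ++ a ∷ y
      square-after-hole : (Σ (List A) λ p → Σ (List A) λ s → Σ (List A) λ r →
                            (s ≢ []) × (z ≡ p ++ (s ++ s) ++ r)) →
                          InnerSquareStart (nothing ∷ full z)
      square-after-hole (p , s , r , s≢[] , z≡pssr) =
        subst InnerSquareStart (cong (nothing ∷_) (trans (sym (full-++₃ p (s ++ s) r)) (cong full (sym z≡pssr))))
          (square-after-prefix (nothing ∷ full p) s (full r) s≢[] (s≤s z≤n))
      prefix≡ : take m z ≡ x ++ c ∷ x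
      prefix≡ = full-⊂-full (subst (_⊂ full (x ++ c ∷ x)) (take-map m z) (tail sq))
      z≡ : z ≡ (x ++ c ∷ x) ++ drop m z
      z≡ = trans (sym (take++drop≡id m z)) (cong (_++ drop m z) prefix≡)
      |z|≡ : length z ≡ length y + suc (length y)
      |z|≡ = length-++ y
      m<|z| : m < length z
      m<|z| = subst (m <_) (length-map just z) (≤-pred hi)
      m≡ : m ≡ length x + suc (length x)
      m≡ = begin
        m                          ≡⟨ sym (m≤n⇒m⊓n≡m (<⇒≤ m<|z|)) ⟩
        m ⊓ length z               ≡⟨ sym (length-take m z) ⟩
        length (take m z)          ≡⟨ cong length prefix≡ ⟩
        length (x ++ c ∷ x)        ≡⟨ length-++ x ⟩
        length x + suc (length x)  ∎
        where open ≡-Reasoning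
      |x|<|y| : length x < length y
      |x|<|y| = half-< (length x) (length y) (subst₂ _<_ m≡ |z|≡ m<|z|)
      |y|≤2|x| : length y ≤ length x + length x
      |y|≤2|x| = ≤-pred (subst₂ _<_ (length-map just y) (trans m≡ (+-suc (length x) (length x))) (≤-pred lo))

lemma4 : ∀ {n : ℕ} (u' v : List (Fin n)) (k : ℕ) →
    Compatible (nothing ∷ full u') (full v) →
    IsSquare (factor 1 (2 * k) ((nothing ∷ full u') ++ full v)) →
    length (nothing ∷ full u') < 2 * k →
    2 * k < length ((nothing ∷ full u') ++ full v) →
    Σ ℕ λ i → Σ ℕ λ j →
    (1 < i) × (i < length ((nothing ∷ full u') ++ full v)) ×
    (i ≤ j) × (j ≤ length ((nothing ∷ full u') ++ full v)) ×
    IsSquare (factor i j ((nothing ∷ full u') ++ full v))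
lemma4 u' v k compatible prefix-square lo hi with compatible-hole-head u' v compatible
... | a , refl =
  subst InnerSquareStart (sym w≡)
    (square-prefix u' a (2 * k) (subst (IsSquare ∘ take (2 * k)) w≡ prefix-square) lo
      (subst (λ w → 2 * k < length w) w≡ hi))
  where
    w≡ : (nothing ∷ full u') ++ full (a ∷ u') ≡ nothing ∷ full (u' ++ a ∷ u')
    w≡ = cong (nothing ∷_) (sym (map-++ just u' (a ∷ u')))
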